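{- Let $P$ be a normal logic program and $q$ an atom occurring in $P$. (1) Let $M$ be a stable model of $P$. If $q\in M$, then $M\setminus\{q\}$ is a stable model of $P(q^+)$; if $q\notin M$, then $M$ is a stable model of $P(q^-)$. (2) $s(P)\le s(P(q^+))+s(P(q^-))$.
   Context: A (normal) logic program is a finite set of clauses $a\leftarrow b_1,\ldots,b_m,\mathbf{not}(c_1),\ldots,\mathbf{not}(c_k)$ with atoms $a,b_i,c_j$. For a set of atoms $M$, the reduct $P^M$ is obtained by deleting every clause whose body contains $\mathbf{not}(c)$ with $c\in M$ and deleting all negative literals from the remaining clauses; $M$ is a stable model of $P$ if $M$ is the least model of $P^M$; $s(P)$ is the number of stable models. For disjoint sets of atoms $T,F$, $simp(P,T,F)$ is obtained from $P$ by: removing all clauses with head in $T\cup F$; removing all clauses containing an atom of $F$ positively in the body; removing all clauses containing $\mathbf{not}(a)$ with $a\in T$ in the body; and removing from the bodies of the remaining clauses all atoms $a\in T$ and all literals $\mathbf{not}(a)$ with $a\in F$. Define $P(q^+)=simp(P,\{q\},\emptyset)$ and $P(q^-)=simp(P,\emptyset,\{q\})$. -}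

module Defs where

open import Data.Nat using (ℕ)
open import Data.Fin using (Fin)
open import Data.Fin.Subset using (Subset; _∈_; _∉_; _⊆_; _∪_)
open import Data.Fin.Subset.Properties using (_∈?_)
open import Data.List using (List; []; _∷_; filter; map; length)
open import Data.List.Relation.Unary.All using (All)
open import Data.List.Relation.Unary.Any using (Any; any?)
open import Data.List.Relation.Unary.Unique.Propositional using (Unique)
import Data.List.Membership.Propositional as LM
open import Data.Product using (_×_; Σ; _,_)
open import Relation.Nullary using (¬_; ¬?)
open import Relation.Nullary.Decidable using (_×-dec_)
open import Function.Bundles using (_⇔_)
open import Data.Sum using (_⊎_)
open import Relation.Binary.PropositionalEquality using (_≡_)

-- Atoms are the elements of Fin n (a finite universe of atoms containing
-- all atoms of the program); sets of atoms are Subset n.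

record Clause (n : ℕ) : Set where
  constructor _←_∣_
  field
    head : Fin n
    pos  : List (Fin n)
    neg  : List (Fin n)
open Clause public

Program : ℕ → Set
Program n = List (Clause n)

DefClause : ℕ → Set
DefClause n = Fin n × List (Fin n)

reduct : ∀ {n} → Program n → Subset n → List (DefClause n)
reduct P M =
  map (λ c → head c , pos c)
      (filter (λ c → ¬? (any? (λ a → a ∈? M) (neg c))) P)

IsModel : ∀ {n} → List (DefClause n) → Subset n → Set
IsModel {n} Q M = ∀ (h : Fin n) (b : List (Fin n)) →
  (h , b) LM.∈ Q → All (λ a → a ∈ M) b → h ∈ M

IsLeastModel : ∀ {n} → List (DefClause n) → Subset n → Set
IsLeastModel Q M = IsModel Q M × (∀ N → IsModel Q N → M ⊆ N)

IsStable : ∀ {n} → Program n → Subset n → Set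
IsStable P M = IsLeastModel (reduct P M) M

-- "P has exactly k stable models": some duplicate-free list of length k
-- enumerates precisely the stable models of P.  (s(P) = k)
NumStable : ∀ {n} → Program n → ℕ → Set
NumStable {n} P k = Σ (List (Subset n)) λ L →
  Unique L × (∀ M → (M LM.∈ L ⇔ IsStable P M)) × length L ≡ k

simp : ∀ {n} → Program n → Subset n → Subset n → Program n
simp {n} P T F =
  map (λ c → head c ← filter (λ a → ¬? (a ∈? T)) (pos c)
                     ∣ filter (λ a → ¬? (a ∈? F)) (neg c))
      (filter keep? P)
  where
  keep? : (c : Clause n) → _
  keep? c = (¬? (head c ∈? (T ∪ F)))
       ×-dec ((¬? (any? (λ a → a ∈? F) (pos c)))
       ×-dec (¬? (any? (λ a → a ∈? T) (neg c))))

open import Data.Fin.Subset using (⁅_⁆; ⊥)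

_⁺[_] : ∀ {n} → Program n → Fin n → Program n
P ⁺[ q ] = simp P ⁅ q ⁆ ⊥

_⁻[_] : ∀ {n} → Program n → Fin n → Program n
P ⁻[ q ] = simp P ⊥ ⁅ q ⁆

OccursIn : ∀ {n} → Fin n → Program n → Set
OccursIn q P = Any (λ c → (q ≡ head c) ⊎ (q LM.∈ pos c) ⊎ (q LM.∈ neg c)) P

{-# OPTIONS --safe #-}
module Submission where

-- Simplification commutes with the reduct: if M is a stable model of P, T ⊆ M and F ∩ M = ∅,
-- then M ─ T is a stable model of simp(P,T,F).  Each clause of the reduct of simp(P,T,F) by
-- M ─ T is the simplification of a clause of P^M, which makes M ─ T a model of it; and for
-- any model N of it, (M ∩ N) ∪ T is a model of P^M, so minimality of M gives M ─ T ⊆ N.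
-- Part (1) is the case T = {q}, F = ∅, resp. T = ∅, F = {q}.  For part (2), the map sending
-- M to inj₁ (M − q) if q ∈ M and to inj₂ M otherwise is injective, and it sends the stable
-- models of P into those of P(q⁺) ⊎ P(q⁻).

open import Defs
open import Data.Nat using (ℕ; _≤_; _+_; s≤s; z≤n)
open import Data.Nat.Properties using (≤-trans; module ≤-Reasoning)
open import Data.Fin using (Fin) renaming (_≟_ to _≟ᶠ_)
open import Data.Fin.Subset using (Subset; _∈_; _∉_; _⊆_; _∪_; _∩_; _─_; _-_; ⁅_⁆; ⊥; inside)
open import Data.Fin.Subset.Properties
  using (_∈?_; ∉⊥; ⊥⊆; p─⊥≡p; p─q⊆p; x∈p∧x∉q⇒x∈p─q; x∈p∧x≢y⇒x∈p-y; x∈⁅y⁆⇒x≡y;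
         x∈p∪q⁺; x∈p∪q⁻; x∈p∩q⁺; x∈p∩q⁻; ⊆-antisym)
open import Data.Bool.Properties using () renaming (_≟_ to _≟ᵇ_)
open import Data.Vec using (_∷_; here; there)
import Data.Vec.Properties as Vec
open import Data.List using (List; []; _∷_; map; filter; length; _++_)
open import Data.List.Properties using (filter-notAll; length-map; length-++)
open import Data.List.Relation.Unary.Any as Any using (Any; here; there)
import Data.List.Relation.Unary.Any.Properties as Anyₚ
open import Data.List.Relation.Unary.All as All using (All)
import Data.List.Relation.Unary.All.Properties as Allₚ
open import Data.List.Relation.Unary.AllPairs using ([]; _∷_)
open import Data.List.Relation.Unary.Unique.Propositional using (Unique)
import Data.List.Relation.Unary.Unique.Propositional.Properties as Unique
open import Data.List.Membership.Propositional using (find; lose) renaming (_∈_ to _∈ₗ_)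
open import Data.List.Relation.Binary.Subset.Propositional using () renaming (_⊆_ to _⊆ₗ_)
open import Data.List.Membership.Propositional.Properties
  using (∈-map⁺; ∈-map⁻; ∈-filter⁺; ∈-filter⁻; ∈-++⁺ˡ; ∈-++⁺ʳ)
open import Data.Product using (_×_; _,_; proj₁; proj₂; ∃-syntax)
open import Data.Sum using (_⊎_; inj₁; inj₂; [_,_])
import Data.Sum.Properties as Sum
open import Data.Empty using (⊥-elim)
open import Function using (_∘_; id)
open import Function.Bundles using (Equivalence)
open import Relation.Nullary using (¬_; ¬?; Dec; yes; no)
open import Relation.Binary.Definitions using (DecidableEquality)
open import Relation.Binary.PropositionalEquality using (_≡_; refl; sym; cong₂; subst)

x∈p─q⇒x∉q : ∀ {n} {x : Fin n} (p q : Subset n) → x ∈ p ─ q → x ∉ q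
x∈p─q⇒x∉q (_ ∷ p) (inside ∷ q) () here
x∈p─q⇒x∉q (_ ∷ p) (_ ∷ q) (there x∈p─q) (there x∈q) = x∈p─q⇒x∉q p q x∈p─q x∈q

p⊆r∧q⊆r⇒p∪q⊆r : ∀ {n} {p q r : Subset n} → p ⊆ r → q ⊆ r → p ∪ q ⊆ r
p⊆r∧q⊆r⇒p∪q⊆r {p = p} {q} p⊆r q⊆r = [ p⊆r , q⊆r ] ∘ x∈p∪q⁻ p q

p-x≡q-x⇒p≡q : ∀ {n} {x : Fin n} {p q : Subset n} → x ∈ p → x ∈ q → p - x ≡ q - x → p ≡ q
p-x≡q-x⇒p≡q {x = x} {p} {q} x∈p x∈q eq = ⊆-antisym (⊆-from x∈q eq) (⊆-from x∈p (sym eq))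
  where
  ⊆-from : ∀ {p q} → x ∈ q → p - x ≡ q - x → p ⊆ q
  ⊆-from {p} {q} x∈q eq {y} y∈p with y ≟ᶠ x
  ... | yes refl = x∈q
  ... | no y≢x = p─q⊆p q ⁅ x ⁆ (subst (y ∈_) eq (x∈p∧x≢y⇒x∈p-y y∈p y≢x))

Unique⇒length≤ : ∀ {a} {A : Set a} → DecidableEquality A →
                 ∀ {xs ys : List A} → Unique xs → xs ⊆ₗ ys → length xs ≤ length ys
Unique⇒length≤ _≟_ [] _ = z≤n
Unique⇒length≤ _≟_ {x ∷ xs} {ys} (x∉xs ∷ xs-unique) x∷xs⊆ys =
  ≤-trans (s≤s (Unique⇒length≤ _≟_ xs-unique xs⊆ys-x)) (filter-notAll (_≢? x) ys x∈ys)
  where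
  _≢?_ : ∀ y x → Dec (¬ y ≡ x)
  y ≢? x = ¬? (y ≟ x)
  x∈ys : Any (λ y → ¬ ¬ y ≡ x) ys
  x∈ys = Any.map (λ x≡y y≢x → y≢x (sym x≡y)) (x∷xs⊆ys (here refl))
  xs⊆ys-x : xs ⊆ₗ filter (_≢? x) ys
  xs⊆ys-x y∈xs = ∈-filter⁺ (_≢? x) (x∷xs⊆ys (there y∈xs)) (All.lookup x∉xs y∈xs ∘ sym)

module _ {n : ℕ} where

  _∉?_ : (a : Fin n) (p : Subset n) → Dec (a ∉ p)
  a ∉? p = ¬? (a ∈? p)

  without : Subset n → List (Fin n) → List (Fin n)
  without p = filter (_∉? p)

  All-without⁺ : ∀ {p q xs} → All (_∈ p ∪ q) xs → All (_∈ p) (without q xs)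
  All-without⁺ {p} {q} {xs} ∈p∪q = All.tabulate λ a∈ →
    let a∈xs , a∉q = ∈-filter⁻ (_∉? q) {xs = xs} a∈
    in [ id , ⊥-elim ∘ a∉q ] (x∈p∪q⁻ p q (All.lookup ∈p∪q a∈xs))

  All-without⁻ : ∀ {p q xs} → All (_∈ p) (without q xs) → All (_∈ p ∪ q) xs
  All-without⁻ {p} {q} {xs} ∈p =
    Allₚ.filter⁻ (_∈? q) (All.map (x∈p∪q⁺ ∘ inj₂) (Allₚ.all-filter (_∈? q) xs))
                         (All.map (x∈p∪q⁺ ∘ inj₁) ∈p)

  Unblocked : Subset n → Clause n → Set
  Unblocked M c = ¬ Any (_∈ M) (neg c)

  ∈-reduct⁻ : ∀ P M {h b} → (h , b) ∈ₗ reduct P M →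
              ∃[ c ] c ∈ₗ P × Unblocked M c × (h , b) ≡ (head c , pos c)
  ∈-reduct⁻ _ _ hb =
    let c , c∈ , eq = ∈-map⁻ _ hb
        c∈P , unblocked = ∈-filter⁻ _ c∈
    in c , c∈P , unblocked , eq

  ∈-reduct⁺ : ∀ {P M c} → c ∈ₗ P → Unblocked M c → (head c , pos c) ∈ₗ reduct P M
  ∈-reduct⁺ c∈P unblocked = ∈-map⁺ _ (∈-filter⁺ _ c∈P unblocked)

  Survives : Subset n → Subset n → Clause n → Set
  Survives T F c = head c ∉ T ∪ F × ¬ Any (_∈ F) (pos c) × ¬ Any (_∈ T) (neg c)

  simplify : Subset n → Subset n → Clause n → Clause n
  simplify T F c = head c ← without T (pos c) ∣ without F (neg c)

  ∈-simp⁻ : ∀ P T F {c′} → c′ ∈ₗ simp P T F →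
            ∃[ c ] c ∈ₗ P × Survives T F c × c′ ≡ simplify T F c
  ∈-simp⁻ _ _ _ c′∈ =
    let c , c∈ , eq = ∈-map⁻ _ c′∈
        c∈P , survives = ∈-filter⁻ _ c∈
    in c , c∈P , survives , eq

  ∈-simp⁺ : ∀ {P} T F {c} → c ∈ₗ P → Survives T F c → simplify T F c ∈ₗ simp P T F
  ∈-simp⁺ _ _ c∈P survives = ∈-map⁺ _ (∈-filter⁺ _ c∈P survives)

module _ {n} (P : Program n) {M T F : Subset n} (M-stable : IsStable P M)
         (T⊆M : T ⊆ M) (F∩M≡∅ : ∀ {x} → x ∈ F → x ∉ M) where

  private
    M-model = proj₁ M-stable
    M-least = proj₂ M-stable

  simp-model : IsModel (reduct (simp P T F) (M ─ T)) (M ─ T)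
  simp-model h b hb body⊆M─T with ∈-reduct⁻ (simp P T F) (M ─ T) hb
  ... | c′ , c′∈ , unblocked′ , refl with ∈-simp⁻ P T F c′∈
  ... | c , c∈P , (head∉T∪F , _ , neg∩T≡∅) , refl =
    x∈p∧x∉q⇒x∈p─q (M-model _ _ (∈-reduct⁺ c∈P unblocked) pos⊆M) (head∉T∪F ∘ x∈p∪q⁺ ∘ inj₁)
    where
    pos⊆M : All (_∈ M) (pos c)
    pos⊆M = All.map (p⊆r∧q⊆r⇒p∪q⊆r (p─q⊆p M T) T⊆M) (All-without⁻ body⊆M─T)
    unblocked : Unblocked M c
    unblocked a∈neg∩M =
      let a , a∈neg , a∈M = find a∈neg∩M
      in unblocked′ (lose (∈-filter⁺ (_∉? F) a∈neg (λ a∈F → F∩M≡∅ a∈F a∈M))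
                          (x∈p∧x∉q⇒x∈p─q a∈M (neg∩T≡∅ ∘ lose a∈neg)))

  simp-least : ∀ N → IsModel (reduct (simp P T F) (M ─ T)) N → M ─ T ⊆ N
  simp-least N N-model x∈M─T =
    [ proj₂ ∘ x∈p∩q⁻ M N , ⊥-elim ∘ x∈p─q⇒x∉q M T x∈M─T ]
      (x∈p∪q⁻ (M ∩ N) T (M-least ((M ∩ N) ∪ T) lifted-model (p─q⊆p M T x∈M─T)))
    where
    lifted-model : IsModel (reduct P M) ((M ∩ N) ∪ T)
    lifted-model h b hb body⊆ with ∈-reduct⁻ P M hb
    ... | c , c∈P , unblocked , refl with head c ∈? T
    ... | yes head∈T = x∈p∪q⁺ (inj₂ head∈T)
    ... | no head∉T = x∈p∪q⁺ (inj₁ (x∈p∩q⁺ (head∈M , head∈N)))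
      where
      pos⊆M : All (_∈ M) (pos c)
      pos⊆M = All.map (p⊆r∧q⊆r⇒p∪q⊆r (proj₁ ∘ x∈p∩q⁻ M N) T⊆M) body⊆
      head∈M : head c ∈ M
      head∈M = M-model _ _ hb pos⊆M
      survives : Survives T F c
      survives =
          (λ head∈T∪F → [ head∉T , (λ head∈F → F∩M≡∅ head∈F head∈M) ] (x∈p∪q⁻ T F head∈T∪F))
        , (λ a∈pos∩F → let a , a∈pos , a∈F = find a∈pos∩F in F∩M≡∅ a∈F (All.lookup pos⊆M a∈pos))
        , unblocked ∘ Any.map T⊆M
      unblocked′ : Unblocked (M ─ T) (simplify T F c)
      unblocked′ = unblocked ∘ Anyₚ.filter⁻ (_∉? F) ∘ Any.map (p─q⊆p M T)
      head∈N : head c ∈ N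
      head∈N = N-model _ _ (∈-reduct⁺ (∈-simp⁺ T F c∈P survives) unblocked′)
                           (All.map (proj₂ ∘ x∈p∩q⁻ M N) (All-without⁺ body⊆))

  simp-stable : IsStable (simp P T F) (M ─ T)
  simp-stable = simp-model , simp-least

module _ {n} (P : Program n) {M : Subset n} {q : Fin n} (M-stable : IsStable P M) where

  ⁺-stable : q ∈ M → IsStable (P ⁺[ q ]) (M - q)
  ⁺-stable q∈M = simp-stable P M-stable ⁅q⁆⊆M (⊥-elim ∘ ∉⊥)
    where
    ⁅q⁆⊆M : ⁅ q ⁆ ⊆ M
    ⁅q⁆⊆M x∈⁅q⁆ = subst (_∈ M) (sym (x∈⁅y⁆⇒x≡y q x∈⁅q⁆)) q∈M

  ⁻-stable : q ∉ M → IsStable (P ⁻[ q ]) M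
  ⁻-stable q∉M = subst (IsStable (P ⁻[ q ])) (p─⊥≡p M) (simp-stable P M-stable ⊥⊆ ⁅q⁆∩M≡∅)
    where
    ⁅q⁆∩M≡∅ : ∀ {x} → x ∈ ⁅ q ⁆ → x ∉ M
    ⁅q⁆∩M≡∅ x∈⁅q⁆ = q∉M ∘ subst (_∈ M) (x∈⁅y⁆⇒x≡y q x∈⁅q⁆)

split : ∀ {n} → Fin n → Subset n → Subset n ⊎ Subset n
split q M with q ∈? M
... | yes _ = inj₁ (M - q)
... | no  _ = inj₂ M

split-injective : ∀ {n} (q : Fin n) {M M′} → split q M ≡ split q M′ → M ≡ M′
split-injective q {M} {M′} eq with q ∈? M | q ∈? M′
... | yes q∈M | yes q∈M′ = p-x≡q-x⇒p≡q q∈M q∈M′ (Sum.inj₁-injective eq)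
... | no  _   | no  _    = Sum.inj₂-injective eq

module _ {n} (P : Program n) (q : Fin n) where

  stable-count : ∀ {s s⁺ s⁻} → NumStable P s → NumStable (P ⁺[ q ]) s⁺ →
                 NumStable (P ⁻[ q ]) s⁻ → s ≤ s⁺ + s⁻
  stable-count (L , L-unique , L-stable , refl) (L⁺ , _ , L⁺-stable , refl)
               (L⁻ , _ , L⁻-stable , refl) = begin
      length L                                     ≡⟨ length-map (split q) L ⟨
      length (map (split q) L)                     ≤⟨ Unique⇒length≤ _≟_ split-L-unique split-L⊆ ⟩
      length (map inj₁ L⁺ ++ map inj₂ L⁻)          ≡⟨ length-++ (map inj₁ L⁺) ⟩
      length (map inj₁ L⁺) + length (map inj₂ L⁻)  ≡⟨ cong₂ _+_ (length-map inj₁ L⁺) (length-map inj₂ L⁻) ⟩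
      length L⁺ + length L⁻                        ∎
    where
    open ≤-Reasoning
    open Equivalence
    _≟_ : DecidableEquality (Subset n ⊎ Subset n)
    _≟_ = Sum.≡-dec (Vec.≡-dec _≟ᵇ_) (Vec.≡-dec _≟ᵇ_)
    split-L-unique : Unique (map (split q) L)
    split-L-unique = Unique.map⁺ (split-injective q) L-unique
    split-stable : ∀ {M} → IsStable P M → split q M ∈ₗ map inj₁ L⁺ ++ map inj₂ L⁻
    split-stable {M} M-stable with q ∈? M
    ... | yes q∈M = ∈-++⁺ˡ (∈-map⁺ inj₁ (from (L⁺-stable (M - q)) (⁺-stable P M-stable q∈M)))
    ... | no  q∉M = ∈-++⁺ʳ (map inj₁ L⁺) (∈-map⁺ inj₂ (from (L⁻-stable M) (⁻-stable P M-stable q∉M)))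
    split-L⊆ : map (split q) L ⊆ₗ map inj₁ L⁺ ++ map inj₂ L⁻
    split-L⊆ y∈ with ∈-map⁻ (split q) y∈
    ... | M , M∈L , refl = split-stable (to (L-stable M) M∈L)

corollary1 : ∀ {n} (P : Program n) (q : Fin n) → OccursIn q P →
    ((M : Subset n) → IsStable P M →
        (q ∈ M → IsStable (P ⁺[ q ]) (M - q))
      × (q ∉ M → IsStable (P ⁻[ q ]) M))
    × (∀ s s⁺ s⁻ → NumStable P s → NumStable (P ⁺[ q ]) s⁺ →
        NumStable (P ⁻[ q ]) s⁻ → s ≤ s⁺ + s⁻)
corollary1 P q _ = (λ M M-stable → ⁺-stable P M-stable , ⁻-stable P M-stable)
                 , (λ _ _ _ → stable-count P q)
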